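{- Every $n$-vertex oriented graph $G$ satisfies $\frac23 t(G)+i(G)\ge\frac1{10}-o_n(1)$.
   Context: An oriented graph is a directed graph with no loops and no multiple (parallel or anti-parallel) edges. $t(G)$ (resp. $i(G)$) is the probability that a uniformly random $3$-set of vertices of $G$ induces a transitive triangle (resp. an independent set). -}

module Defs where

open import Data.Bool using (Bool; true; false; _∧_; _∨_; if_then_else_)
open import Data.Nat using (ℕ; _<ᵇ_)
open import Data.Fin using (Fin; toℕ)
open import Data.Nat.ListAction using (sum)
open import Data.List using (List; map; concatMap; allFin)
open import Relation.Binary.PropositionalEquality using (_≡_)
open import Data.Integer using (+_)
open import Data.Rational using (ℚ; _/_)

record OrientedGraph (n : ℕ) : Set where
  field
    arc        : Fin n → Fin n → Bool
    loopless   : ∀ u → arc u u ≡ false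
    antisym    : ∀ u v → arc u v ∧ arc v u ≡ false
open OrientedGraph public

module _ {n : ℕ} (G : OrientedGraph n) where
  adj : Fin n → Fin n → Bool
  adj u v = arc G u v ∨ arc G v u

  isTransitive : Fin n → Fin n → Fin n → Bool
  isTransitive a b c =
    (arc G a b ∧ arc G a c ∧ adj b c) ∨
    (arc G b a ∧ arc G b c ∧ adj a c) ∨
    (arc G c a ∧ arc G c b ∧ adj a b)

  isIndependent : Fin n → Fin n → Fin n → Bool
  isIndependent a b c =
    if adj a b ∨ adj a c ∨ adj b c then false else true

count3 : (n : ℕ) → (Fin n → Fin n → Fin n → Bool) → ℕ
count3 n P =
  sum (concatMap (λ i → concatMap (λ j → map (λ k →
         if (toℕ i <ᵇ toℕ j) ∧ (toℕ j <ᵇ toℕ k) ∧ P i j k then 1 else 0)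
       (allFin n)) (allFin n)) (allFin n))

transCount : {n : ℕ} → OrientedGraph n → ℕ
transCount {n} G = count3 n (isTransitive G)

indepCount : {n : ℕ} → OrientedGraph n → ℕ
indepCount {n} G = count3 n (isIndependent G)

ℕ→ℚ : ℕ → ℚ
ℕ→ℚ m = (+ m) / 1

-- At a vertex v, split the other n - 1 vertices into out-neighbours, in-neighbours and
-- non-neighbours, of sizes a, b, c. A pair {x, y} is alike at v if x and y lie in the same
-- class, and mixed at v if one is a non-neighbour and the other a neighbour. Per vertex, AM-GM
-- gives (a + b + c)² + 10 c (a + b) ≤ 10 (a² + b² + c²), i.e.
--   (n - 1)² + 10 mixed(v) ≤ 20 alike(v) + 10 (n - 1).
-- Per triple, looking at the pairs alike or mixed at each of its three vertices, a check over
-- the 27 orientations of a triangle gives 2 alike ≤ 6 [independent] + 4 [transitive] + mixed.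
-- Summing both and eliminating the mixed pairs yields n (n - 1)² ≤ 10 n (n - 1) + 60 I + 40 T,
-- that is (2/3) T + I ≥ (1/10) C(n,3) - O(n²).

module Submission where

module Counting where

  open import Data.Bool using (Bool; true; false; _∧_; _∨_; not; if_then_else_; T)
  open import Data.Unit using (tt)
  open import Data.Bool.Properties using (∧-assoc; ∧-zeroʳ)
  open import Data.Fin using (Fin; zero; suc; toℕ)
  open import Data.Fin.Properties using (toℕ-injective) renaming (_≟_ to _≟ᶠ_; <⇒≢ to <⇒≢ᶠ)
  open import Data.List using (List; map; concatMap; tabulate; allFin)
  open import Data.Nat using (ℕ; zero; suc; _+_; _*_; _∸_; _≤_; z≤n; _<ᵇ_; _≡ᵇ_; _≟_) renaming (_<_ to _<ℕ_)
  open import Data.Nat.Combinatorics using (_C_; nCk+nC[k+1]≡[n+1]C[k+1]; nC1≡n)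
  open import Data.Nat.ListAction using () renaming (sum to sumˡ)
  open import Data.Nat.ListAction.Properties using (sum-++)
  open import Data.Nat.Properties
  open import Data.Nat.Tactic.RingSolver using (solve-∀)
  open import Data.Sum using (inj₁; inj₂)
  open import Function using (_∘_; id)
  open import Relation.Binary.PropositionalEquality
  open import Relation.Nullary using (yes; no; contradiction)
  open import Relation.Nullary.Decidable using (dec-true; dec-false)

  open import Algebra.Properties.Semiring.Sum +-*-semiring
    using (∑-distrib-+; ∑-comm; *-distribˡ-sum; *-distribʳ-sum; sum-cong-≗; sum-replicate-zero)
    renaming (sum to ∑)

  open import Defs

  private
    2*[m*n]≤m*m+n*n-≤ : ∀ {m n} → m ≤ n → 2 * (m * n) ≤ m * m + n * n
    2*[m*n]≤m*m+n*n-≤ {m} {n} m≤n = subst (λ n → 2 * (m * n) ≤ m * m + n * n) (m+[n∸m]≡n m≤n)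
      (subst (2 * (m * (m + (n ∸ m))) ≤_) (gap m (n ∸ m)) (m≤m+n _ ((n ∸ m) * (n ∸ m))))
      where
      gap : ∀ m k → 2 * (m * (m + k)) + k * k ≡ m * m + (m + k) * (m + k)
      gap = solve-∀

  2*[m*n]≤m*m+n*n : ∀ m n → 2 * (m * n) ≤ m * m + n * n
  2*[m*n]≤m*m+n*n m n with ≤-total m n
  ... | inj₁ m≤n = 2*[m*n]≤m*m+n*n-≤ m≤n
  ... | inj₂ n≤m = subst₂ _≤_ (cong (2 *_) (*-comm n m)) (+-comm (n * n) (m * m)) (2*[m*n]≤m*m+n*n-≤ n≤m)

  -- AM-GM, first on 2 (a + b) and 3 c to absorb the cross term 12 c (a + b), then on a and b.
  vertex-inequality : ∀ a b c →
    (a + b + c) * (a + b + c) + 10 * (c * (a + b)) ≤ 10 * (a * a + b * b + c * c)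
  vertex-inequality a b c = begin
    (a + b + c) * (a + b + c) + 10 * (c * (a + b))
      ≡⟨ expand a b c ⟩
    (a + b) * (a + b) + c * c + 2 * ((2 * (a + b)) * (3 * c))
      ≤⟨ +-monoʳ-≤ ((a + b) * (a + b) + c * c) (2*[m*n]≤m*m+n*n (2 * (a + b)) (3 * c)) ⟩
    (a + b) * (a + b) + c * c + ((2 * (a + b)) * (2 * (a + b)) + (3 * c) * (3 * c))
      ≡⟨ collect a b c ⟩
    5 * (2 * (a * b)) + 5 * (a * a + b * b) + 10 * (c * c)
      ≤⟨ +-monoˡ-≤ (10 * (c * c)) (+-monoˡ-≤ (5 * (a * a + b * b)) (*-monoʳ-≤ 5 (2*[m*n]≤m*m+n*n a b))) ⟩
    5 * (a * a + b * b) + 5 * (a * a + b * b) + 10 * (c * c)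
      ≡⟨ regroup a b c ⟩
    10 * (a * a + b * b + c * c) ∎
    where
    open ≤-Reasoning
    expand : ∀ a b c → (a + b + c) * (a + b + c) + 10 * (c * (a + b))
                     ≡ (a + b) * (a + b) + c * c + 2 * ((2 * (a + b)) * (3 * c))
    expand = solve-∀
    collect : ∀ a b c → (a + b) * (a + b) + c * c + ((2 * (a + b)) * (2 * (a + b)) + (3 * c) * (3 * c))
                      ≡ 5 * (2 * (a * b)) + 5 * (a * a + b * b) + 10 * (c * c)
    collect = solve-∀
    regroup : ∀ a b c → 5 * (a * a + b * b) + 5 * (a * a + b * b) + 10 * (c * c)
                      ≡ 10 * (a * a + b * b + c * c)
    regroup = solve-∀

  𝟙 : Bool → ℕ
  𝟙 b = if b then 1 else 0

  𝟙-∧ : ∀ a b → 𝟙 (a ∧ b) ≡ 𝟙 a * 𝟙 b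
  𝟙-∧ true  b = sym (+-identityʳ (𝟙 b))
  𝟙-∧ false b = refl

  𝟙-idem : ∀ b → 𝟙 b * 𝟙 b ≡ 𝟙 b
  𝟙-idem true  = refl
  𝟙-idem false = refl

  <ᵇ-trichotomy : ∀ a b → 𝟙 (a <ᵇ b) + 𝟙 (b <ᵇ a) + 𝟙 (a ≡ᵇ b) ≡ 1
  <ᵇ-trichotomy zero    zero    = refl
  <ᵇ-trichotomy zero    (suc b) = refl
  <ᵇ-trichotomy (suc a) zero    = refl
  <ᵇ-trichotomy (suc a) (suc b) = <ᵇ-trichotomy a b

  ≢⇒<ᵇ-connex : ∀ {a b} → a ≢ b → 𝟙 (a <ᵇ b) + 𝟙 (b <ᵇ a) ≡ 1
  ≢⇒<ᵇ-connex {a} {b} a≢b = trans (sym (+-identityʳ _))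
    (subst (λ e → 𝟙 (a <ᵇ b) + 𝟙 (b <ᵇ a) + 𝟙 e ≡ 1) (dec-false (a ≟ b) a≢b) (<ᵇ-trichotomy a b))

  -- p lies below, between or above q and r.
  placements : ∀ {p q r} → p ≢ q → p ≢ r →
    𝟙 ((p <ᵇ q) ∧ (q <ᵇ r)) + 𝟙 ((q <ᵇ p) ∧ (p <ᵇ r)) + 𝟙 ((q <ᵇ r) ∧ (r <ᵇ p)) ≡ 𝟙 (q <ᵇ r)
  placements {zero}  {zero}           p≢q _   = contradiction refl p≢q
  placements {zero}  {suc q} {zero}   _   p≢r = contradiction refl p≢r
  placements {zero}  {suc q} {suc r}  _   _   rewrite ∧-zeroʳ (q <ᵇ r) = trans (+-identityʳ _) (+-identityʳ _)
  placements {suc p} {zero}  {zero}   _   _   = refl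
  placements {suc p} {zero}  {suc r}  _   p≢r = ≢⇒<ᵇ-connex (p≢r ∘ cong suc)
  placements {suc p} {suc q} {zero}   _   _   rewrite ∧-zeroʳ (p <ᵇ q) | ∧-zeroʳ (q <ᵇ p) = refl
  placements {suc p} {suc q} {suc r}  p≢q p≢r = placements (p≢q ∘ cong suc) (p≢r ∘ cong suc)

  <ᵇ≡true⇒< : ∀ {a b} → (a <ᵇ b) ≡ true → a <ℕ b
  <ᵇ≡true⇒< {a} {b} a<b = <ᵇ⇒< a b (subst T (sym a<b) tt)

  _≡ᶠ_ : ∀ {n} → Fin n → Fin n → Bool
  x ≡ᶠ y = toℕ x ≡ᵇ toℕ y

  ≡ᶠ-refl : ∀ {n} (x : Fin n) → (x ≡ᶠ x) ≡ true
  ≡ᶠ-refl x = dec-true (toℕ x ≟ toℕ x) refl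

  ≢⇒≡ᶠ-false : ∀ {n} {x y : Fin n} → x ≢ y → (x ≡ᶠ y) ≡ false
  ≢⇒≡ᶠ-false {x = x} {y} x≢y = dec-false (toℕ x ≟ toℕ y) (x≢y ∘ toℕ-injective)

  ⟦_<_⟧ : ∀ {n} → Fin n → Fin n → ℕ
  ⟦ x < y ⟧ = 𝟙 (toℕ x <ᵇ toℕ y)

  ⟦_<_<_⟧ : ∀ {n} → Fin n → Fin n → Fin n → ℕ
  ⟦ i < j < k ⟧ = 𝟙 ((toℕ i <ᵇ toℕ j) ∧ (toℕ j <ᵇ toℕ k))

  -- Finite sums over Fin n

  ∑₂ : ∀ {n} → (Fin n → Fin n → ℕ) → ℕ
  ∑₂ f = ∑ λ x → ∑ (f x)

  ∑₃ : ∀ {n} → (Fin n → Fin n → Fin n → ℕ) → ℕ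
  ∑₃ f = ∑ λ x → ∑₂ (f x)

  ∑-mono-≤ : ∀ {n} {f g : Fin n → ℕ} → (∀ i → f i ≤ g i) → ∑ f ≤ ∑ g
  ∑-mono-≤ {zero}  _   = z≤n
  ∑-mono-≤ {suc n} f≤g = +-mono-≤ (f≤g zero) (∑-mono-≤ (f≤g ∘ suc))

  ∑-const : ∀ n c → ∑ {n} (λ _ → c) ≡ n * c
  ∑-const zero    c = refl
  ∑-const (suc n) c = cong (c +_) (∑-const n c)

  ∑-*-∑ : ∀ {m n} (f : Fin m → ℕ) (g : Fin n → ℕ) → ∑ (λ x → ∑ (λ y → f x * g y)) ≡ ∑ f * ∑ g
  ∑-*-∑ f g = trans (sum-cong-≗ (λ x → sym (*-distribˡ-sum (f x) g))) (sym (*-distribʳ-sum (∑ g) f))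

  ∑-δ : ∀ {n} (x : Fin n) (f : Fin n → ℕ) → ∑ (λ y → 𝟙 (x ≡ᶠ y) * f y) ≡ f x
  ∑-δ {suc n} zero    f = trans (cong₂ _+_ (*-identityˡ (f zero)) (sum-replicate-zero n)) (+-identityʳ _)
  ∑-δ {suc n} (suc x) f = ∑-δ x (f ∘ suc)

  ∑₂-cong : ∀ {n} {f g : Fin n → Fin n → ℕ} → (∀ x y → f x y ≡ g x y) → ∑₂ f ≡ ∑₂ g
  ∑₂-cong f≡g = sum-cong-≗ (λ x → sum-cong-≗ (f≡g x))

  ∑₃-cong : ∀ {n} {f g : Fin n → Fin n → Fin n → ℕ} → (∀ x y z → f x y z ≡ g x y z) → ∑₃ f ≡ ∑₃ g
  ∑₃-cong f≡g = sum-cong-≗ (λ x → ∑₂-cong (f≡g x))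

  ∑₃-mono-≤ : ∀ {n} {f g : Fin n → Fin n → Fin n → ℕ} → (∀ x y z → f x y z ≤ g x y z) → ∑₃ f ≤ ∑₃ g
  ∑₃-mono-≤ f≤g = ∑-mono-≤ (λ x → ∑-mono-≤ (λ y → ∑-mono-≤ (f≤g x y)))

  ∑₂-distrib-+ : ∀ {n} (f g : Fin n → Fin n → ℕ) → ∑₂ (λ x y → f x y + g x y) ≡ ∑₂ f + ∑₂ g
  ∑₂-distrib-+ f g = trans (sum-cong-≗ (λ x → ∑-distrib-+ (f x) (g x))) (∑-distrib-+ (∑ ∘ f) (∑ ∘ g))

  ∑₃-distrib-+ : ∀ {n} (f g : Fin n → Fin n → Fin n → ℕ) → ∑₃ (λ x y z → f x y z + g x y z) ≡ ∑₃ f + ∑₃ g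
  ∑₃-distrib-+ f g = trans (sum-cong-≗ (λ x → ∑₂-distrib-+ (f x) (g x))) (∑-distrib-+ (∑₂ ∘ f) (∑₂ ∘ g))

  ∑₃-distrib-+₃ : ∀ {n} (f g h : Fin n → Fin n → Fin n → ℕ) →
    ∑₃ (λ x y z → f x y z + g x y z + h x y z) ≡ ∑₃ f + ∑₃ g + ∑₃ h
  ∑₃-distrib-+₃ f g h = trans (∑₃-distrib-+ (λ x y z → f x y z + g x y z) h) (cong (_+ ∑₃ h) (∑₃-distrib-+ f g))

  *-distribˡ-∑₃ : ∀ {n} c (f : Fin n → Fin n → Fin n → ℕ) → c * ∑₃ f ≡ ∑₃ (λ x y z → c * f x y z)
  *-distribˡ-∑₃ c f = trans (*-distribˡ-sum c (∑₂ ∘ f)) (sum-cong-≗ λ x →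
    trans (*-distribˡ-sum c (∑ ∘ f x)) (sum-cong-≗ λ y → *-distribˡ-sum c (f x y)))

  sumˡ-map-tabulate : ∀ {A : Set} {n} (f : A → ℕ) (h : Fin n → A) → sumˡ (map f (tabulate h)) ≡ ∑ (f ∘ h)
  sumˡ-map-tabulate {n = zero}  f h = refl
  sumˡ-map-tabulate {n = suc n} f h = cong (f (h zero) +_) (sumˡ-map-tabulate f (h ∘ suc))

  sumˡ-concatMap-tabulate : ∀ {A : Set} {n} (g : A → List ℕ) (h : Fin n → A) →
    sumˡ (concatMap g (tabulate h)) ≡ ∑ (sumˡ ∘ g ∘ h)
  sumˡ-concatMap-tabulate {n = zero}  g h = refl
  sumˡ-concatMap-tabulate {n = suc n} g h =
    trans (sum-++ (g (h zero)) _) (cong (sumˡ (g (h zero)) +_) (sumˡ-concatMap-tabulate g (h ∘ suc)))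

  count3≡∑₃ : ∀ n (P : Fin n → Fin n → Fin n → Bool) →
    count3 n P ≡ ∑₃ (λ i j k → ⟦ i < j < k ⟧ * 𝟙 (P i j k))
  count3≡∑₃ n P =
    trans (sumˡ-concatMap-tabulate (λ i → concatMap (λ j → map (F i j) (allFin n)) (allFin n)) id) (sum-cong-≗ λ i →
    trans (sumˡ-concatMap-tabulate (λ j → map (F i j) (allFin n)) id) (sum-cong-≗ λ j →
    trans (sumˡ-map-tabulate (F i j) id) (sum-cong-≗ λ k →
    trans (cong 𝟙 (sym (∧-assoc (lt i j) (lt j k) (P i j k)))) (𝟙-∧ (lt i j ∧ lt j k) (P i j k)))))
    where
    lt : Fin n → Fin n → Bool
    lt a b = toℕ a <ᵇ toℕ b
    F : Fin n → Fin n → Fin n → ℕ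
    F i j k = 𝟙 (lt i j ∧ lt j k ∧ P i j k)

  ∑₂-symmetric : ∀ {n} (f : Fin n → Fin n → ℕ) → (∀ x y → f x y ≡ f y x) →
    ∑₂ f ≡ 2 * ∑₂ (λ x y → ⟦ x < y ⟧ * f x y) + ∑ (λ x → f x x)
  ∑₂-symmetric f f-sym = begin
    ∑₂ f
      ≡⟨ ∑₂-cong split ⟩
    ∑₂ (λ x y → ⟦ x < y ⟧ * f x y + ⟦ y < x ⟧ * f x y + 𝟙 (x ≡ᶠ y) * f x y)
      ≡⟨ ∑₂-distrib-+ _ (λ x y → 𝟙 (x ≡ᶠ y) * f x y) ⟩
    ∑₂ (λ x y → ⟦ x < y ⟧ * f x y + ⟦ y < x ⟧ * f x y) + ∑₂ (λ x y → 𝟙 (x ≡ᶠ y) * f x y)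
      ≡⟨ cong₂ _+_ (∑₂-distrib-+ (λ x y → ⟦ x < y ⟧ * f x y) (λ x y → ⟦ y < x ⟧ * f x y))
                   (sum-cong-≗ (λ x → ∑-δ x (f x))) ⟩
    below + ∑₂ (λ x y → ⟦ y < x ⟧ * f x y) + ∑ (λ x → f x x)
      ≡⟨ cong (λ s → below + s + ∑ (λ x → f x x)) transpose ⟩
    below + below + ∑ (λ x → f x x)
      ≡⟨ cong (_+ ∑ (λ x → f x x)) (double below) ⟩
    2 * below + ∑ (λ x → f x x) ∎
    where
    open ≡-Reasoning
    below = ∑₂ (λ x y → ⟦ x < y ⟧ * f x y)
    distrib : ∀ a b c d → (a + b + c) * d ≡ a * d + b * d + c * d
    distrib = solve-∀
    double : ∀ a → a + a ≡ 2 * a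
    double = solve-∀
    split : ∀ x y → f x y ≡ ⟦ x < y ⟧ * f x y + ⟦ y < x ⟧ * f x y + 𝟙 (x ≡ᶠ y) * f x y
    split x y = trans (sym (*-identityˡ (f x y)))
      (trans (cong (_* f x y) (sym (<ᵇ-trichotomy (toℕ x) (toℕ y)))) (distrib ⟦ x < y ⟧ ⟦ y < x ⟧ (𝟙 (x ≡ᶠ y)) (f x y)))
    transpose : ∑₂ (λ x y → ⟦ y < x ⟧ * f x y) ≡ below
    transpose = trans (∑-comm (λ x y → ⟦ y < x ⟧ * f x y)) (∑₂-cong (λ x y → cong (⟦ x < y ⟧ *_) (f-sym y x)))

  apexSum : ∀ {n} → (Fin n → Fin n → Fin n → ℕ) → Fin n → Fin n → Fin n → ℕ
  apexSum h i j k = h i j k + h j i k + h k i j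

  -- Each term h v x y with x < y is counted exactly once, at the position of v relative to x < y.
  ∑-increasing-triples : ∀ {n} (h : Fin n → Fin n → Fin n → ℕ) →
    (∀ x y → h x x y ≡ 0) → (∀ x y → h y x y ≡ 0) →
    ∑₃ (λ i j k → ⟦ i < j < k ⟧ * apexSum h i j k) ≡ ∑₃ (λ v x y → ⟦ x < y ⟧ * h v x y)
  ∑-increasing-triples h h-vanishes₁ h-vanishes₂ = begin
    ∑₃ (λ i j k → ⟦ i < j < k ⟧ * apexSum h i j k)
      ≡⟨ ∑₃-cong (λ i j k → expand ⟦ i < j < k ⟧ (h i j k) (h j i k) (h k i j)) ⟩
    ∑₃ (λ i j k → ⟦ i < j < k ⟧ * h i j k + ⟦ i < j < k ⟧ * h j i k + ⟦ i < j < k ⟧ * h k i j)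
      ≡⟨ ∑₃-distrib-+₃ (λ i j k → ⟦ i < j < k ⟧ * h i j k) (λ i j k → ⟦ i < j < k ⟧ * h j i k)
                       (λ i j k → ⟦ i < j < k ⟧ * h k i j) ⟩
    ∑₃ (λ v x y → ⟦ v < x < y ⟧ * h v x y) + ∑₃ (λ i j k → ⟦ i < j < k ⟧ * h j i k)
      + ∑₃ (λ i j k → ⟦ i < j < k ⟧ * h k i j)
      ≡⟨ cong₂ (λ s t → ∑₃ (λ v x y → ⟦ v < x < y ⟧ * h v x y) + s + t) middle last ⟩
    ∑₃ (λ v x y → ⟦ v < x < y ⟧ * h v x y) + ∑₃ (λ v x y → ⟦ x < v < y ⟧ * h v x y)
      + ∑₃ (λ v x y → ⟦ x < y < v ⟧ * h v x y)
      ≡⟨ sym (∑₃-distrib-+₃ (λ v x y → ⟦ v < x < y ⟧ * h v x y) (λ v x y → ⟦ x < v < y ⟧ * h v x y)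
                            (λ v x y → ⟦ x < y < v ⟧ * h v x y)) ⟩
    ∑₃ (λ v x y → ⟦ v < x < y ⟧ * h v x y + ⟦ x < v < y ⟧ * h v x y + ⟦ x < y < v ⟧ * h v x y)
      ≡⟨ ∑₃-cong (λ v x y → trans (factor ⟦ v < x < y ⟧ ⟦ x < v < y ⟧ ⟦ x < y < v ⟧ (h v x y)) (placed v x y)) ⟩
    ∑₃ (λ v x y → ⟦ x < y ⟧ * h v x y) ∎
    where
    open ≡-Reasoning
    expand : ∀ w a b c → w * (a + b + c) ≡ w * a + w * b + w * c
    expand = solve-∀
    factor : ∀ a b c d → a * d + b * d + c * d ≡ (a + b + c) * d
    factor = solve-∀
    middle : ∑₃ (λ i j k → ⟦ i < j < k ⟧ * h j i k) ≡ ∑₃ (λ v x y → ⟦ x < v < y ⟧ * h v x y)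
    middle = ∑-comm (λ i j → ∑ (λ k → ⟦ i < j < k ⟧ * h j i k))
    last : ∑₃ (λ i j k → ⟦ i < j < k ⟧ * h k i j) ≡ ∑₃ (λ v x y → ⟦ x < y < v ⟧ * h v x y)
    last = trans (sum-cong-≗ (λ i → ∑-comm (λ j k → ⟦ i < j < k ⟧ * h k i j)))
                 (∑-comm (λ i k → ∑ (λ j → ⟦ i < j < k ⟧ * h k i j)))
    placed : ∀ v x y → (⟦ v < x < y ⟧ + ⟦ x < v < y ⟧ + ⟦ x < y < v ⟧) * h v x y ≡ ⟦ x < y ⟧ * h v x y
    placed v x y with v ≟ᶠ x | v ≟ᶠ y
    ... | yes refl | _        rewrite h-vanishes₁ v y =
      trans (*-zeroʳ (⟦ v < v < y ⟧ + ⟦ v < v < y ⟧ + ⟦ v < y < v ⟧)) (sym (*-zeroʳ ⟦ v < y ⟧))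
    ... | no _     | yes refl rewrite h-vanishes₂ x v =
      trans (*-zeroʳ (⟦ v < x < v ⟧ + ⟦ x < v < v ⟧ + ⟦ x < v < v ⟧)) (sym (*-zeroʳ ⟦ x < v ⟧))
    ... | no v≢x   | no v≢y   =
      cong (_* h v x y) (placements (v≢x ∘ toℕ-injective) (v≢y ∘ toℕ-injective))

  -- Neighbourhood classes at a vertex

  -- A link from v to x is recorded by the Booleans (arc v x, arc x v, v = x).
  nonAdjacent : Bool → Bool → Bool → Bool
  nonAdjacent p q e = not (p ∨ q ∨ e)

  alike : (p q e p′ q′ e′ : Bool) → ℕ
  alike p q e p′ q′ e′ = 𝟙 p * 𝟙 p′ + 𝟙 q * 𝟙 q′ + 𝟙 (nonAdjacent p q e) * 𝟙 (nonAdjacent p′ q′ e′)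

  mixed : (p q e p′ q′ e′ : Bool) → ℕ
  mixed p q e p′ q′ e′ = 𝟙 (nonAdjacent p q e) * (𝟙 p′ + 𝟙 q′) + (𝟙 p + 𝟙 q) * 𝟙 (nonAdjacent p′ q′ e′)

  data Orientation : Bool → Bool → Set where
    forward  : Orientation true false
    backward : Orientation false true
    none     : Orientation false false

  orientation : ∀ p q → p ∧ q ≡ false → Orientation p q
  orientation true  false _ = forward
  orientation false true  _ = backward
  orientation false false _ = none

  link-partition : ∀ {p q} → Orientation p q → 𝟙 p + 𝟙 q + 𝟙 (nonAdjacent p q false) ≡ 1
  link-partition forward  = refl
  link-partition backward = refl
  link-partition none     = refl

  mixed-diagonal : ∀ p q e → mixed p q e p q e ≡ 0
  mixed-diagonal true  true  e     = refl
  mixed-diagonal true  false e     = refl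
  mixed-diagonal false true  e     = refl
  mixed-diagonal false false true  = refl
  mixed-diagonal false false false = refl

  -- The two Boolean expressions on the right are isIndependent and isTransitive unfolded.
  triangle-inequality : ∀ {ij ji ik ki jk kj} → Orientation ij ji → Orientation ik ki → Orientation jk kj →
    2 * (alike ij ji false ik ki false + alike ji ij false jk kj false + alike ki ik false kj jk false)
    ≤ 6 * 𝟙 (if (ij ∨ ji) ∨ (ik ∨ ki) ∨ (jk ∨ kj) then false else true)
      + 4 * 𝟙 ((ij ∧ ik ∧ (jk ∨ kj)) ∨ (ji ∧ jk ∧ (ik ∨ ki)) ∨ (ki ∧ kj ∧ (ij ∨ ji)))
      + (mixed ij ji false ik ki false + mixed ji ij false jk kj false + mixed ki ik false kj jk false)
  triangle-inequality forward  forward  forward  = ≤ᵇ⇒≤ _ _ tt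
  triangle-inequality forward  forward  backward = ≤ᵇ⇒≤ _ _ tt
  triangle-inequality forward  forward  none     = ≤ᵇ⇒≤ _ _ tt
  triangle-inequality forward  backward forward  = ≤ᵇ⇒≤ _ _ tt
  triangle-inequality forward  backward backward = ≤ᵇ⇒≤ _ _ tt
  triangle-inequality forward  backward none     = ≤ᵇ⇒≤ _ _ tt
  triangle-inequality forward  none     forward  = ≤ᵇ⇒≤ _ _ tt
  triangle-inequality forward  none     backward = ≤ᵇ⇒≤ _ _ tt
  triangle-inequality forward  none     none     = ≤ᵇ⇒≤ _ _ tt
  triangle-inequality backward forward  forward  = ≤ᵇ⇒≤ _ _ tt
  triangle-inequality backward forward  backward = ≤ᵇ⇒≤ _ _ tt
  triangle-inequality backward forward  none     = ≤ᵇ⇒≤ _ _ tt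
  triangle-inequality backward backward forward  = ≤ᵇ⇒≤ _ _ tt
  triangle-inequality backward backward backward = ≤ᵇ⇒≤ _ _ tt
  triangle-inequality backward backward none     = ≤ᵇ⇒≤ _ _ tt
  triangle-inequality backward none     forward  = ≤ᵇ⇒≤ _ _ tt
  triangle-inequality backward none     backward = ≤ᵇ⇒≤ _ _ tt
  triangle-inequality backward none     none     = ≤ᵇ⇒≤ _ _ tt
  triangle-inequality none     forward  forward  = ≤ᵇ⇒≤ _ _ tt
  triangle-inequality none     forward  backward = ≤ᵇ⇒≤ _ _ tt
  triangle-inequality none     forward  none     = ≤ᵇ⇒≤ _ _ tt
  triangle-inequality none     backward forward  = ≤ᵇ⇒≤ _ _ tt
  triangle-inequality none     backward backward = ≤ᵇ⇒≤ _ _ tt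
  triangle-inequality none     backward none     = ≤ᵇ⇒≤ _ _ tt
  triangle-inequality none     none     forward  = ≤ᵇ⇒≤ _ _ tt
  triangle-inequality none     none     backward = ≤ᵇ⇒≤ _ _ tt
  triangle-inequality none     none     none     = ≤ᵇ⇒≤ _ _ tt

  module _ {n : ℕ} (G : OrientedGraph n) where

    out into apart : Fin n → Fin n → ℕ
    out   v x = 𝟙 (arc G v x)
    into  v x = 𝟙 (arc G x v)
    apart v x = 𝟙 (nonAdjacent (arc G v x) (arc G x v) (v ≡ᶠ x))

    outdeg indeg nondeg : Fin n → ℕ
    outdeg v = ∑ (out v)
    indeg  v = ∑ (into v)
    nondeg v = ∑ (apart v)

    alikeAt mixedAt : Fin n → Fin n → Fin n → ℕ
    alikeAt v x y = alike (arc G v x) (arc G x v) (v ≡ᶠ x) (arc G v y) (arc G y v) (v ≡ᶠ y)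
    mixedAt v x y = mixed (arc G v x) (arc G x v) (v ≡ᶠ x) (arc G v y) (arc G y v) (v ≡ᶠ y)

    degree-partition : ∀ v x → out v x + into v x + apart v x + 𝟙 (v ≡ᶠ x) ≡ 1
    degree-partition v x with v ≟ᶠ x
    ... | yes refl rewrite loopless G v | ≡ᶠ-refl v = refl
    ... | no v≢x   rewrite ≢⇒≡ᶠ-false v≢x =
      trans (+-identityʳ _) (link-partition (orientation (arc G v x) (arc G x v) (antisym G v x)))

    ∑-classes : ∀ v → ∑ (λ x → out v x + into v x + apart v x) ≡ outdeg v + indeg v + nondeg v
    ∑-classes v = trans (∑-distrib-+ (λ x → out v x + into v x) (apart v))
                        (cong (_+ nondeg v) (∑-distrib-+ (out v) (into v)))

    degree-sum : ∀ v → outdeg v + indeg v + nondeg v ≡ n ∸ 1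
    degree-sum v = trans (sym (m+n∸n≡m (outdeg v + indeg v + nondeg v) 1)) (cong (_∸ 1) (begin
      outdeg v + indeg v + nondeg v + 1
        ≡⟨ cong₂ _+_ (sym (∑-classes v)) (sym self-once) ⟩
      ∑ (λ x → out v x + into v x + apart v x) + ∑ (λ x → 𝟙 (v ≡ᶠ x))
        ≡⟨ sym (∑-distrib-+ (λ x → out v x + into v x + apart v x) (λ x → 𝟙 (v ≡ᶠ x))) ⟩
      ∑ (λ x → out v x + into v x + apart v x + 𝟙 (v ≡ᶠ x))
        ≡⟨ trans (sum-cong-≗ (degree-partition v)) (trans (∑-const n 1) (*-identityʳ n)) ⟩
      n ∎))
      where
      open ≡-Reasoning
      self-once : ∑ (λ x → 𝟙 (v ≡ᶠ x)) ≡ 1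
      self-once = begin
        ∑ (λ x → 𝟙 (v ≡ᶠ x))     ≡⟨ sum-cong-≗ (λ x → sym (*-identityʳ (𝟙 (v ≡ᶠ x)))) ⟩
        ∑ (λ x → 𝟙 (v ≡ᶠ x) * 1) ≡⟨ ∑-δ v (λ _ → 1) ⟩
        1                        ∎

    alikeAt-sym : ∀ v x y → alikeAt v x y ≡ alikeAt v y x
    alikeAt-sym v x y = swap (out v x) (out v y) (into v x) (into v y) (apart v x) (apart v y)
      where
      swap : ∀ a a′ b b′ c c′ → a * a′ + b * b′ + c * c′ ≡ a′ * a + b′ * b + c′ * c
      swap = solve-∀

    mixedAt-sym : ∀ v x y → mixedAt v x y ≡ mixedAt v y x
    mixedAt-sym v x y = swap (apart v x) (out v y + into v y) (out v x + into v x) (apart v y)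
      where
      swap : ∀ a b c d → a * b + c * d ≡ d * c + b * a
      swap = solve-∀

    alikeAt-self : ∀ v y → alikeAt v v y ≡ 0
    alikeAt-self v y rewrite loopless G v | ≡ᶠ-refl v = refl

    mixedAt-self : ∀ v y → mixedAt v v y ≡ 0
    mixedAt-self v y rewrite loopless G v | ≡ᶠ-refl v = refl

    ∑-alikeAt-diagonal : ∀ v → ∑ (λ x → alikeAt v x x) ≡ n ∸ 1
    ∑-alikeAt-diagonal v = begin
      ∑ (λ x → alikeAt v x x)
        ≡⟨ sum-cong-≗ (λ x → cong₂ _+_ (cong₂ _+_ (𝟙-idem (arc G v x)) (𝟙-idem (arc G x v)))
                                       (𝟙-idem (nonAdjacent (arc G v x) (arc G x v) (v ≡ᶠ x)))) ⟩
      ∑ (λ x → out v x + into v x + apart v x)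
        ≡⟨ ∑-classes v ⟩
      outdeg v + indeg v + nondeg v
        ≡⟨ degree-sum v ⟩
      n ∸ 1 ∎
      where open ≡-Reasoning

    ∑-mixedAt-diagonal : ∀ v → ∑ (λ x → mixedAt v x x) ≡ 0
    ∑-mixedAt-diagonal v = trans (sum-cong-≗ (λ x → mixed-diagonal (arc G v x) (arc G x v) (v ≡ᶠ x)))
                                 (sum-replicate-zero n)

    ∑₂-alikeAt : ∀ v → ∑₂ (alikeAt v) ≡ outdeg v * outdeg v + indeg v * indeg v + nondeg v * nondeg v
    ∑₂-alikeAt v = begin
      ∑₂ (alikeAt v)
        ≡⟨ ∑₂-distrib-+ (λ x y → out v x * out v y + into v x * into v y) (λ x y → apart v x * apart v y) ⟩
      ∑₂ (λ x y → out v x * out v y + into v x * into v y) + ∑₂ (λ x y → apart v x * apart v y)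
        ≡⟨ cong (_+ ∑₂ (λ x y → apart v x * apart v y))
                (∑₂-distrib-+ (λ x y → out v x * out v y) (λ x y → into v x * into v y)) ⟩
      ∑₂ (λ x y → out v x * out v y) + ∑₂ (λ x y → into v x * into v y) + ∑₂ (λ x y → apart v x * apart v y)
        ≡⟨ cong₂ _+_ (cong₂ _+_ (∑-*-∑ (out v) (out v)) (∑-*-∑ (into v) (into v))) (∑-*-∑ (apart v) (apart v)) ⟩
      outdeg v * outdeg v + indeg v * indeg v + nondeg v * nondeg v ∎
      where open ≡-Reasoning

    ∑₂-mixedAt : ∀ v → ∑₂ (mixedAt v) ≡ 2 * (nondeg v * (outdeg v + indeg v))
    ∑₂-mixedAt v = begin
      ∑₂ (mixedAt v)
        ≡⟨ ∑₂-distrib-+ (λ x y → apart v x * adjacent y) (λ x y → adjacent x * apart v y) ⟩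
      ∑₂ (λ x y → apart v x * adjacent y) + ∑₂ (λ x y → adjacent x * apart v y)
        ≡⟨ cong₂ _+_ (∑-*-∑ (apart v) adjacent) (∑-*-∑ adjacent (apart v)) ⟩
      nondeg v * ∑ adjacent + ∑ adjacent * nondeg v
        ≡⟨ cong (λ d → nondeg v * d + d * nondeg v) (∑-distrib-+ (out v) (into v)) ⟩
      nondeg v * (outdeg v + indeg v) + (outdeg v + indeg v) * nondeg v
        ≡⟨ double (nondeg v) (outdeg v + indeg v) ⟩
      2 * (nondeg v * (outdeg v + indeg v)) ∎
      where
      open ≡-Reasoning
      adjacent : Fin n → ℕ
      adjacent x = out v x + into v x
      double : ∀ c d → c * d + d * c ≡ 2 * (c * d)
      double = solve-∀

    alikePairs mixedPairs : Fin n → ℕ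
    alikePairs v = ∑₂ (λ x y → ⟦ x < y ⟧ * alikeAt v x y)
    mixedPairs v = ∑₂ (λ x y → ⟦ x < y ⟧ * mixedAt v x y)

    alikePairs-count : ∀ v →
      2 * alikePairs v + (n ∸ 1) ≡ outdeg v * outdeg v + indeg v * indeg v + nondeg v * nondeg v
    alikePairs-count v = begin
      2 * alikePairs v + (n ∸ 1)                 ≡⟨ cong (2 * alikePairs v +_) (sym (∑-alikeAt-diagonal v)) ⟩
      2 * alikePairs v + ∑ (λ x → alikeAt v x x) ≡⟨ sym (∑₂-symmetric (alikeAt v) (alikeAt-sym v)) ⟩
      ∑₂ (alikeAt v)                             ≡⟨ ∑₂-alikeAt v ⟩
      outdeg v * outdeg v + indeg v * indeg v + nondeg v * nondeg v ∎
      where open ≡-Reasoning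

    mixedPairs-count : ∀ v → mixedPairs v ≡ nondeg v * (outdeg v + indeg v)
    mixedPairs-count v = *-cancelˡ-≡ _ _ 2 (begin
      2 * mixedPairs v                           ≡⟨ sym (+-identityʳ _) ⟩
      2 * mixedPairs v + 0                       ≡⟨ cong (2 * mixedPairs v +_) (sym (∑-mixedAt-diagonal v)) ⟩
      2 * mixedPairs v + ∑ (λ x → mixedAt v x x) ≡⟨ sym (∑₂-symmetric (mixedAt v) (mixedAt-sym v)) ⟩
      ∑₂ (mixedAt v)                             ≡⟨ ∑₂-mixedAt v ⟩
      2 * (nondeg v * (outdeg v + indeg v))      ∎)
      where open ≡-Reasoning

    local-inequality : ∀ v → (n ∸ 1) * (n ∸ 1) + 10 * mixedPairs v ≤ 20 * alikePairs v + 10 * (n ∸ 1)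
    local-inequality v = begin
      (n ∸ 1) * (n ∸ 1) + 10 * mixedPairs v
        ≡⟨ cong₂ (λ m q → m * m + 10 * q) (sym (degree-sum v)) (mixedPairs-count v) ⟩
      (a + b + c) * (a + b + c) + 10 * (c * (a + b))
        ≤⟨ vertex-inequality a b c ⟩
      10 * (a * a + b * b + c * c)
        ≡⟨ cong (10 *_) (sym (alikePairs-count v)) ⟩
      10 * (2 * alikePairs v + (n ∸ 1))
        ≡⟨ distrib (alikePairs v) (n ∸ 1) ⟩
      20 * alikePairs v + 10 * (n ∸ 1) ∎
      where
      open ≤-Reasoning
      a = outdeg v
      b = indeg v
      c = nondeg v
      distrib : ∀ p m → 10 * (2 * p + m) ≡ 20 * p + 10 * m
      distrib = solve-∀

    triangle-inequality-at : ∀ {i j k} → i ≢ j → i ≢ k → j ≢ k →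
      2 * apexSum alikeAt i j k
        ≤ 6 * 𝟙 (isIndependent G i j k) + 4 * 𝟙 (isTransitive G i j k) + apexSum mixedAt i j k
    triangle-inequality-at {i} {j} {k} i≢j i≢k j≢k
      rewrite ≢⇒≡ᶠ-false i≢j | ≢⇒≡ᶠ-false i≢k | ≢⇒≡ᶠ-false j≢k
            | ≢⇒≡ᶠ-false (i≢j ∘ sym) | ≢⇒≡ᶠ-false (i≢k ∘ sym) | ≢⇒≡ᶠ-false (j≢k ∘ sym)
      = triangle-inequality (orient i j) (orient i k) (orient j k)
      where
      orient : ∀ x y → Orientation (arc G x y) (arc G y x)
      orient x y = orientation (arc G x y) (arc G y x) (antisym G x y)

    weighted-triangle-inequality : ∀ i j k →
      ⟦ i < j < k ⟧ * (2 * apexSum alikeAt i j k)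
        ≤ ⟦ i < j < k ⟧ * (6 * 𝟙 (isIndependent G i j k) + 4 * 𝟙 (isTransitive G i j k) + apexSum mixedAt i j k)
    weighted-triangle-inequality i j k with toℕ i <ᵇ toℕ j in i<j | toℕ j <ᵇ toℕ k in j<k
    ... | false | _     = z≤n
    ... | true  | false = z≤n
    ... | true  | true  = *-monoʳ-≤ 1
      (triangle-inequality-at (<⇒≢ᶠ (<ᵇ≡true⇒< i<j)) (<⇒≢ᶠ (<-trans (<ᵇ≡true⇒< i<j) (<ᵇ≡true⇒< j<k)))
                              (<⇒≢ᶠ (<ᵇ≡true⇒< j<k)))

    totalAlikePairs totalMixedPairs : ℕ
    totalAlikePairs = ∑ alikePairs
    totalMixedPairs = ∑ mixedPairs

    triangle-count : 2 * totalAlikePairs ≤ 6 * indepCount G + 4 * transCount G + totalMixedPairs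
    triangle-count = begin
      2 * totalAlikePairs
        ≡⟨ cong (2 *_) (sym (∑-increasing-triples alikeAt alikeAt-self alikeAt-self′)) ⟩
      2 * ∑₃ (λ i j k → ⟦ i < j < k ⟧ * apexSum alikeAt i j k)
        ≡⟨ *-distribˡ-∑₃ 2 (λ i j k → ⟦ i < j < k ⟧ * apexSum alikeAt i j k) ⟩
      ∑₃ (λ i j k → 2 * (⟦ i < j < k ⟧ * apexSum alikeAt i j k))
        ≡⟨ ∑₃-cong (λ i j k → *-comm-middle 2 ⟦ i < j < k ⟧ (apexSum alikeAt i j k)) ⟩
      ∑₃ (λ i j k → ⟦ i < j < k ⟧ * (2 * apexSum alikeAt i j k))
        ≤⟨ ∑₃-mono-≤ weighted-triangle-inequality ⟩
      ∑₃ (λ i j k → ⟦ i < j < k ⟧ * (6 * indep i j k + 4 * transitive i j k + apexSum mixedAt i j k))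
        ≡⟨ ∑₃-cong (λ i j k → expand ⟦ i < j < k ⟧ (indep i j k) (transitive i j k) (apexSum mixedAt i j k)) ⟩
      ∑₃ (λ i j k → 6 * (⟦ i < j < k ⟧ * indep i j k) + 4 * (⟦ i < j < k ⟧ * transitive i j k)
                    + ⟦ i < j < k ⟧ * apexSum mixedAt i j k)
        ≡⟨ ∑₃-distrib-+₃ (λ i j k → 6 * (⟦ i < j < k ⟧ * indep i j k)) (λ i j k → 4 * (⟦ i < j < k ⟧ * transitive i j k))
                         (λ i j k → ⟦ i < j < k ⟧ * apexSum mixedAt i j k) ⟩
      ∑₃ (λ i j k → 6 * (⟦ i < j < k ⟧ * indep i j k)) + ∑₃ (λ i j k → 4 * (⟦ i < j < k ⟧ * transitive i j k))
        + ∑₃ (λ i j k → ⟦ i < j < k ⟧ * apexSum mixedAt i j k)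
        ≡⟨ cong₂ _+_ (cong₂ _+_ (counted 6 (isIndependent G)) (counted 4 (isTransitive G)))
                     (∑-increasing-triples mixedAt mixedAt-self mixedAt-self′) ⟩
      6 * indepCount G + 4 * transCount G + totalMixedPairs ∎
      where
      open ≤-Reasoning
      indep transitive : Fin n → Fin n → Fin n → ℕ
      indep i j k = 𝟙 (isIndependent G i j k)
      transitive i j k = 𝟙 (isTransitive G i j k)
      alikeAt-self′ : ∀ x y → alikeAt y x y ≡ 0
      alikeAt-self′ x y = trans (alikeAt-sym y x y) (alikeAt-self y x)
      mixedAt-self′ : ∀ x y → mixedAt y x y ≡ 0
      mixedAt-self′ x y = trans (mixedAt-sym y x y) (mixedAt-self y x)
      *-comm-middle : ∀ a b c → a * (b * c) ≡ b * (a * c)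
      *-comm-middle = solve-∀
      expand : ∀ w a b c → w * (6 * a + 4 * b + c) ≡ 6 * (w * a) + 4 * (w * b) + w * c
      expand = solve-∀
      counted : ∀ c P → ∑₃ (λ i j k → c * (⟦ i < j < k ⟧ * 𝟙 (P i j k))) ≡ c * count3 n P
      counted c P = trans (sym (*-distribˡ-∑₃ c (λ i j k → ⟦ i < j < k ⟧ * 𝟙 (P i j k))))
                            (cong (c *_) (sym (count3≡∑₃ n P)))

    vertex-count : n * ((n ∸ 1) * (n ∸ 1)) + 10 * totalMixedPairs ≤ 20 * totalAlikePairs + 10 * (n * (n ∸ 1))
    vertex-count = begin
      n * (m * m) + 10 * totalMixedPairs
        ≡⟨ cong₂ _+_ (sym (∑-const n (m * m))) (*-distribˡ-sum 10 mixedPairs) ⟩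
      ∑ {n} (λ _ → m * m) + ∑ (λ v → 10 * mixedPairs v)
        ≡⟨ sym (∑-distrib-+ {n} (λ _ → m * m) (λ v → 10 * mixedPairs v)) ⟩
      ∑ (λ v → m * m + 10 * mixedPairs v)
        ≤⟨ ∑-mono-≤ local-inequality ⟩
      ∑ (λ v → 20 * alikePairs v + 10 * m)
        ≡⟨ ∑-distrib-+ {n} (λ v → 20 * alikePairs v) (λ _ → 10 * m) ⟩
      ∑ (λ v → 20 * alikePairs v) + ∑ {n} (λ _ → 10 * m)
        ≡⟨ cong₂ _+_ (sym (*-distribˡ-sum 20 alikePairs)) (trans (∑-const n (10 * m)) (*-comm-middle n 10 m)) ⟩
      20 * totalAlikePairs + 10 * (n * m) ∎
      where
      open ≤-Reasoning
      m = n ∸ 1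
      *-comm-middle : ∀ a b c → a * (b * c) ≡ b * (a * c)
      *-comm-middle = solve-∀

    indep-trans-bound : n * ((n ∸ 1) * (n ∸ 1)) ≤ 10 * (n * (n ∸ 1)) + (60 * indepCount G + 40 * transCount G)
    indep-trans-bound = +-cancelʳ-≤ (10 * totalMixedPairs) _ _ (begin
      n * ((n ∸ 1) * (n ∸ 1)) + 10 * totalMixedPairs
        ≤⟨ vertex-count ⟩
      20 * totalAlikePairs + 10 * (n * (n ∸ 1))
        ≡⟨ cong (_+ 10 * (n * (n ∸ 1))) (*-assoc 10 2 totalAlikePairs) ⟩
      10 * (2 * totalAlikePairs) + 10 * (n * (n ∸ 1))
        ≤⟨ +-monoˡ-≤ (10 * (n * (n ∸ 1))) (*-monoʳ-≤ 10 triangle-count) ⟩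
      10 * (6 * indepCount G + 4 * transCount G + totalMixedPairs) + 10 * (n * (n ∸ 1))
        ≡⟨ regroup (indepCount G) (transCount G) totalMixedPairs (n * (n ∸ 1)) ⟩
      10 * (n * (n ∸ 1)) + (60 * indepCount G + 40 * transCount G) + 10 * totalMixedPairs ∎)
      where
      open ≤-Reasoning
      regroup : ∀ i t q p → 10 * (6 * i + 4 * t + q) + 10 * p ≡ 10 * p + (60 * i + 40 * t) + 10 * q
      regroup = solve-∀

  2*[1+k]C2 : ∀ k → 2 * ((1 + k) C 2) ≡ (1 + k) * k
  2*[1+k]C2 zero    = refl
  2*[1+k]C2 (suc k) = begin
    2 * ((2 + k) C 2)                     ≡⟨ cong (2 *_) (sym (nCk+nC[k+1]≡[n+1]C[k+1] (1 + k) 1)) ⟩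
    2 * ((1 + k) C 1 + (1 + k) C 2)       ≡⟨ *-distribˡ-+ 2 ((1 + k) C 1) ((1 + k) C 2) ⟩
    2 * ((1 + k) C 1) + 2 * ((1 + k) C 2) ≡⟨ cong₂ (λ a b → 2 * a + b) (nC1≡n (1 + k)) (2*[1+k]C2 k) ⟩
    2 * (1 + k) + (1 + k) * k             ≡⟨ step k ⟩
    (2 + k) * (1 + k)                     ∎
    where
    open ≡-Reasoning
    step : ∀ k → 2 * (1 + k) + (1 + k) * k ≡ (2 + k) * (1 + k)
    step = solve-∀

  6*[2+k]C3 : ∀ k → 6 * ((2 + k) C 3) ≡ (2 + k) * ((1 + k) * k)
  6*[2+k]C3 zero    = refl
  6*[2+k]C3 (suc k) = begin
    6 * ((3 + k) C 3)
      ≡⟨ cong (6 *_) (sym (nCk+nC[k+1]≡[n+1]C[k+1] (2 + k) 2)) ⟩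
    6 * ((2 + k) C 2 + (2 + k) C 3)
      ≡⟨ *-distribˡ-+ 6 ((2 + k) C 2) ((2 + k) C 3) ⟩
    6 * ((2 + k) C 2) + 6 * ((2 + k) C 3)
      ≡⟨ cong₂ _+_ (*-assoc 3 2 ((2 + k) C 2)) (6*[2+k]C3 k) ⟩
    3 * (2 * ((2 + k) C 2)) + (2 + k) * ((1 + k) * k)
      ≡⟨ cong (λ a → 3 * a + (2 + k) * ((1 + k) * k)) (2*[1+k]C2 (suc k)) ⟩
    3 * ((2 + k) * (1 + k)) + (2 + k) * ((1 + k) * k)
      ≡⟨ step k ⟩
    (3 + k) * ((2 + k) * (1 + k)) ∎
    where
    open ≡-Reasoning
    step : ∀ k → 3 * ((2 + k) * (1 + k)) + (2 + k) * ((1 + k) * k) ≡ (3 + k) * ((2 + k) * (1 + k))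
    step = solve-∀

  6*[2+k]C3≤9*[2+k]*[1+k]+z : ∀ k z →
    (2 + k) * ((1 + k) * (1 + k)) ≤ 10 * ((2 + k) * (1 + k)) + z →
    6 * ((2 + k) C 3) ≤ 9 * ((2 + k) * (1 + k)) + z
  6*[2+k]C3≤9*[2+k]*[1+k]+z k z bound = +-cancelʳ-≤ K (6 * ((2 + k) C 3)) (9 * K + z) (begin
    6 * ((2 + k) C 3) + K         ≡⟨ cong (_+ K) (6*[2+k]C3 k) ⟩
    (2 + k) * ((1 + k) * k) + K   ≡⟨ factor k ⟩
    (2 + k) * ((1 + k) * (1 + k)) ≤⟨ bound ⟩
    10 * K + z                    ≡⟨ split K z ⟩
    9 * K + z + K                 ∎)
    where
    open ≤-Reasoning
    K = (2 + k) * (1 + k)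
    factor : ∀ k → (2 + k) * ((1 + k) * k) + (2 + k) * (1 + k) ≡ (2 + k) * ((1 + k) * (1 + k))
    factor = solve-∀
    split : ∀ K z → 10 * K + z ≡ 9 * K + z + K
    split = solve-∀

  -- The theorem for n = 2 + k and ε = (1 + p) / D, multiplied by 30 D: with D ≤ n - 2,
  -- ε C(n,3) absorbs the error term 3 n (n - 1) / 20 left by indep-trans-bound.
  cleared-bound : ∀ k p D I T → D ≤ k →
    (2 + k) * ((1 + k) * (1 + k)) ≤ 10 * ((2 + k) * (1 + k)) + (60 * I + 40 * T) →
    3 * D * ((2 + k) C 3) ≤ 30 * suc p * ((2 + k) C 3) + D * (20 * T + 30 * I)
  cleared-bound k p D I T D≤k bound = *-cancelˡ-≤ 2 (begin
    2 * (3 * D * Cn)                              ≡⟨ regroup₁ D Cn ⟩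
    D * (6 * Cn)                                  ≤⟨ *-monoʳ-≤ D (6*[2+k]C3≤9*[2+k]*[1+k]+z k Z bound) ⟩
    D * (9 * K + Z)                               ≡⟨ regroup₂ D K Z ⟩
    9 * (D * K) + D * Z                           ≤⟨ +-monoˡ-≤ (D * Z) (*-monoʳ-≤ 9 DK≤6C) ⟩
    9 * (6 * Cn) + D * Z                          ≤⟨ +-monoˡ-≤ (D * Z) 54C≤60PC ⟩
    60 * suc p * Cn + D * Z                       ≡⟨ regroup₃ (suc p) Cn D I T ⟩
    2 * (30 * suc p * Cn + D * (20 * T + 30 * I)) ∎)
    where
    open ≤-Reasoning
    Cn = (2 + k) C 3
    K = (2 + k) * (1 + k)
    Z = 60 * I + 40 * T
    regroup₁ : ∀ D Cn → 2 * (3 * D * Cn) ≡ D * (6 * Cn)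
    regroup₁ = solve-∀
    regroup₂ : ∀ D K Z → D * (9 * K + Z) ≡ 9 * (D * K) + D * Z
    regroup₂ = solve-∀
    regroup₃ : ∀ P Cn D I T → 60 * P * Cn + D * (60 * I + 40 * T) ≡ 2 * (30 * P * Cn + D * (20 * T + 30 * I))
    regroup₃ = solve-∀
    DK≤6C : D * K ≤ 6 * Cn
    DK≤6C = begin
      D * K                   ≤⟨ *-monoˡ-≤ K D≤k ⟩
      k * K                   ≡⟨ reorder k ⟩
      (2 + k) * ((1 + k) * k) ≡⟨ sym (6*[2+k]C3 k) ⟩
      6 * Cn                  ∎
      where
      reorder : ∀ k → k * ((2 + k) * (1 + k)) ≡ (2 + k) * ((1 + k) * k)
      reorder = solve-∀
    54C≤60PC : 9 * (6 * Cn) ≤ 60 * suc p * Cn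
    54C≤60PC = begin
      9 * (6 * Cn)    ≤⟨ *-monoˡ-≤ (6 * Cn) (n≤1+n 9) ⟩
      10 * (6 * Cn)   ≡⟨ sym (*-assoc 10 6 Cn) ⟩
      60 * Cn         ≤⟨ *-monoˡ-≤ Cn (m≤m*n 60 (suc p)) ⟩
      60 * suc p * Cn ∎

open import Defs
open import Data.Nat using (ℕ) renaming (_≤_ to _≤ℕ_)
open import Data.Nat.Combinatorics using (_C_)
open import Data.Integer using (+_)
open import Data.Rational using (ℚ; _/_; _+_; _*_; _-_; _<_; _≤_; 0ℚ)
open import Data.Product using (∃-syntax)

import Data.Nat as ℕ
open import Data.Nat using (suc; s≤s)
import Data.Integer as ℤ
import Data.Integer.Properties as ℤ
import Data.Rational.Unnormalised as ℚᵘ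
import Data.Rational.Unnormalised.Properties as ℚᵘ
open import Data.Integer.Tactic.RingSolver using (solve-∀)
open import Data.Nat.Coprimality using (Coprime)
open import Data.Product using (_,_)
open import Data.Rational using (mkℚ; toℚᵘ; *<*)
open import Data.Rational.Properties using (toℚᵘ-cancel-≤; toℚᵘ-homo-*; toℚᵘ-homo-+; toℚᵘ-homo‿-; toℚᵘ-fromℚᵘ)
open import Relation.Binary.PropositionalEquality using (_≡_; sym; trans; cong; cong₂; subst₂)

open Counting using (indep-trans-bound; cleared-bound)

pos-*-* : ∀ a b c → + (a ℕ.* b ℕ.* c) ≡ + a ℤ.* + b ℤ.* + c
pos-*-* a b c = trans (ℤ.pos-* (a ℕ.* b) c) (cong (ℤ._* + c) (ℤ.pos-* a b))

-- Clearing denominators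

-- The shape is that of ℚᵘ._≤_ unfolded on the two sides of the theorem.
cross-multiplied : ∀ P D Cn T I →
  3 ℕ.* D ℕ.* Cn ℕ.≤ 30 ℕ.* P ℕ.* Cn ℕ.+ D ℕ.* (20 ℕ.* T ℕ.+ 30 ℕ.* I) →
  ((+ 1) ℤ.* (+ D) ℤ.+ (ℤ.- (+ P)) ℤ.* (+ 10)) ℤ.* (+ Cn) ℤ.* (+ 3)
    ℤ.≤ ((+ 2 ℤ.* + T) ℤ.* (+ 1) ℤ.+ (+ I) ℤ.* (+ 3)) ℤ.* (+ (10 ℕ.* D ℕ.* 1))
cross-multiplied P D Cn T I bound =
  subst₂ ℤ._≤_ (sym (left (+ D) (+ P) (+ Cn))) (sym right) (ℤ.+-monoˡ-≤ (ℤ.- b) a≤b+e)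
  where
  a b e : ℤ.ℤ
  a = + 3 ℤ.* + D ℤ.* + Cn
  b = + 30 ℤ.* + P ℤ.* + Cn
  e = + D ℤ.* (+ 20 ℤ.* + T ℤ.+ + 30 ℤ.* + I)
  a≤b+e : a ℤ.≤ b ℤ.+ e
  a≤b+e = subst₂ ℤ._≤_ (pos-*-* 3 D Cn)
    (trans (ℤ.pos-+ (30 ℕ.* P ℕ.* Cn) (D ℕ.* (20 ℕ.* T ℕ.+ 30 ℕ.* I)))
      (cong₂ ℤ._+_ (pos-*-* 30 P Cn)
        (trans (ℤ.pos-* D (20 ℕ.* T ℕ.+ 30 ℕ.* I))
          (cong (+ D ℤ.*_) (trans (ℤ.pos-+ (20 ℕ.* T) (30 ℕ.* I)) (cong₂ ℤ._+_ (ℤ.pos-* 20 T) (ℤ.pos-* 30 I)))))))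
    (ℤ.+≤+ bound)
  left : ∀ D P Cn → ((+ 1) ℤ.* D ℤ.+ (ℤ.- P) ℤ.* (+ 10)) ℤ.* Cn ℤ.* (+ 3)
                  ≡ + 3 ℤ.* D ℤ.* Cn ℤ.+ ℤ.- (+ 30 ℤ.* P ℤ.* Cn)
  left = solve-∀
  right : ((+ 2 ℤ.* + T) ℤ.* (+ 1) ℤ.+ (+ I) ℤ.* (+ 3)) ℤ.* (+ (10 ℕ.* D ℕ.* 1)) ≡ b ℤ.+ e ℤ.+ ℤ.- b
  right = trans (cong (((+ 2 ℤ.* + T) ℤ.* (+ 1) ℤ.+ (+ I) ℤ.* (+ 3)) ℤ.*_)
                      (pos-*-* 10 D 1))
                (expand (+ D) (+ P) (+ Cn) (+ T) (+ I))
    where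
    expand : ∀ D P Cn T I → ((+ 2 ℤ.* T) ℤ.* (+ 1) ℤ.+ I ℤ.* (+ 3)) ℤ.* (+ 10 ℤ.* D ℤ.* + 1)
           ≡ (+ 30 ℤ.* P ℤ.* Cn) ℤ.+ D ℤ.* (+ 20 ℤ.* T ℤ.+ + 30 ℤ.* I) ℤ.+ ℤ.- (+ 30 ℤ.* P ℤ.* Cn)
    expand = solve-∀

cleared-bound⇒ℚ-bound : ∀ p d Cn T I .(c : Coprime (suc p) (suc d)) →
  3 ℕ.* suc d ℕ.* Cn ℕ.≤ 30 ℕ.* suc p ℕ.* Cn ℕ.+ suc d ℕ.* (20 ℕ.* T ℕ.+ 30 ℕ.* I) →
  ((+ 1 / 10) - mkℚ (+ suc p) d c) * ℕ→ℚ Cn ≤ ((+ 2 / 3) * ℕ→ℚ T) + ℕ→ℚ I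
cleared-bound⇒ℚ-bound p d Cn T I c bound =
  toℚᵘ-cancel-≤ (ℚᵘ.≤-respˡ-≃ (ℚᵘ.≃-sym left) (ℚᵘ.≤-respʳ-≃ (ℚᵘ.≃-sym right)
    (ℚᵘ.*≤* (cross-multiplied (suc p) (suc d) Cn T I bound))))
  where
  ε = mkℚ (+ suc p) d c
  left : toℚᵘ (((+ 1 / 10) - ε) * ℕ→ℚ Cn)
           ℚᵘ.≃ (ℚᵘ.mkℚᵘ (+ 1) 9 ℚᵘ.- ℚᵘ.mkℚᵘ (+ suc p) d) ℚᵘ.* ℚᵘ.mkℚᵘ (+ Cn) 0
  left = ℚᵘ.≃-trans (toℚᵘ-homo-* ((+ 1 / 10) - ε) (ℕ→ℚ Cn))
    (ℚᵘ.*-cong (ℚᵘ.≃-trans (toℚᵘ-homo-+ (+ 1 / 10) (Data.Rational.- ε))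
                           (ℚᵘ.+-cong (ℚᵘ.≃-refl {ℚᵘ.mkℚᵘ (+ 1) 9}) (toℚᵘ-homo‿- ε)))
               (toℚᵘ-fromℚᵘ (ℚᵘ.mkℚᵘ (+ Cn) 0)))
  right : toℚᵘ (((+ 2 / 3) * ℕ→ℚ T) + ℕ→ℚ I)
            ℚᵘ.≃ (ℚᵘ.mkℚᵘ (+ 2) 2 ℚᵘ.* ℚᵘ.mkℚᵘ (+ T) 0) ℚᵘ.+ ℚᵘ.mkℚᵘ (+ I) 0
  right = ℚᵘ.≃-trans (toℚᵘ-homo-+ ((+ 2 / 3) * ℕ→ℚ T) (ℕ→ℚ I))
    (ℚᵘ.+-cong (ℚᵘ.≃-trans (toℚᵘ-homo-* (+ 2 / 3) (ℕ→ℚ T))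
                           (ℚᵘ.*-cong (ℚᵘ.≃-refl {ℚᵘ.mkℚᵘ (+ 2) 2}) (toℚᵘ-fromℚᵘ (ℚᵘ.mkℚᵘ (+ T) 0))))
               (toℚᵘ-fromℚᵘ (ℚᵘ.mkℚᵘ (+ I) 0)))

proposition4p5 : (ε : ℚ) → 0ℚ < ε → ∃[ N ] ((n : ℕ) → N ≤ℕ n → (G : OrientedGraph n) →
    ((+ 1 / 10) - ε) * ℕ→ℚ (n C 3)
      ≤ ((+ 2 / 3) * ℕ→ℚ (transCount G)) + ℕ→ℚ (indepCount G))
-- ε = (1 + p) / (1 + d): mkℚ stores the denominator minus one.
proposition4p5 (mkℚ (+ suc p) d c) _ = 3 ℕ.+ d , bound
  where
  bound : (n : ℕ) → 3 ℕ.+ d ≤ℕ n → (G : OrientedGraph n) →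
    ((+ 1 / 10) - mkℚ (+ suc p) d c) * ℕ→ℚ (n C 3) ≤ ((+ 2 / 3) * ℕ→ℚ (transCount G)) + ℕ→ℚ (indepCount G)
  bound (suc (suc k)) (s≤s (s≤s 1+d≤k)) G =
    cleared-bound⇒ℚ-bound p d _ (transCount G) (indepCount G) c
      (cleared-bound k p (suc d) (indepCount G) (transCount G) 1+d≤k (indep-trans-bound G))
proposition4p5 (mkℚ (+ 0) d c) (*<* (ℤ.+<+ ()))
proposition4p5 (mkℚ ℤ.-[1+ n ] d c) (*<* ())
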